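{- Let $r$ be a positive integer. Then $\omega(n)\to\infty$ as $n\to\infty$ through elements $n\in F_r$.
   Context: $\omega(n)$ is the number of distinct prime factors of $n$. For a positive integer $r$, $S_r$ is the multiplicative function with $S_r(q^\alpha)=0$ if $q\le r$ and $S_r(q^\alpha)=q^{\alpha-1}(q-r)$ if $q>r$. $B_r=\{n\in\mathbb{N}: S_r(n)>0\}$. $F_r$ is the set of $n\in B_r$ with $S_r(n)<S_r(m)$ for all $m\in B_r$, $m>n$ (this set is infinite). -}

module Defs where

open import Data.Nat using (ℕ; zero; suc; _+_; _*_; _∸_; _^_; _≤_; _<_; _≤ᵇ_)
open import Data.Nat.Divisibility using (_∣_; _∣?_)
open import Data.Nat.Primality using (Prime; prime?)
open import Data.List using (List; filter; length; map; upTo)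
open import Data.Nat.ListAction using (product)
open import Data.Product using (_×_; Σ; ∃; _,_)
open import Data.Bool using (if_then_else_)
open import Relation.Nullary using (Dec; yes; no)
open import Relation.Nullary.Decidable using (_×-dec_)

primeDivisors : ℕ → List ℕ
primeDivisors n = filter (λ p → prime? p ×-dec (p ∣? n)) (upTo (suc n))

ω : ℕ → ℕ
ω n = length (primeDivisors n)

-- v p n = the largest k ≤ n with p ^ k ∣ n  (the p-adic valuation of n for
-- n ≥ 1 and p ≥ 2, since then p ^ k ∣ n forces k < n).
v : ℕ → ℕ → ℕ
v p n = go n
  where
  go : ℕ → ℕ
  go zero = zero
  go (suc k) with (p ^ suc k) ∣? n
  ... | yes _ = suc k
  ... | no  _ = go k

Sprimepow : ℕ → ℕ → ℕ → ℕ
Sprimepow r q α = if q ≤ᵇ r then 0 else q ^ (α ∸ 1) * (q ∸ r)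

-- S_r as the multiplicative function determined by its prime-power values:
-- S_r(n) = ∏_{q ∣ n prime} S_r(q^{v_q(n)}) for n ≥ 1 (S_r(1) = 1).
S : ℕ → ℕ → ℕ
S r n = product (map (λ q → Sprimepow r q (v q n)) (primeDivisors n))

B : ℕ → ℕ → Set
B r n = (1 ≤ n) × (0 < S r n)

F : ℕ → ℕ → Set
F r n = B r n × (∀ m → B r m → n < m → S r n < S r m)

-- If n ∈ B_r, every prime factor q of n exceeds r and q^α ≤ (r+1)·S_r(q^α), so
-- n ≤ (r+1)^ω(n) · S_r(n). If every prime factor of m exceeds r, then
-- S_r(m) = m · ∏_{q ∣ m} (1 − r/q). Euler's product together with the dyadic blocks of the
-- harmonic sum gives ∏_{p ≤ 2^J} p/(p−1) ≥ J/2, so for C = p·(r+1)^K, with p a prime > r,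
-- there is a finite set T of primes > r with C · ∏_{q ∈ T} (1 − r/q) ≤ 1. Given n ∈ F_r with
-- n ≥ ∏T and ω(n) < K, pick n⁺ = ∏T · p^k with n < n⁺ ≤ p·n. Then n⁺ ∈ B_r and
-- C · S_r(n⁺) ≤ n⁺ ≤ p·n ≤ C · S_r(n), contradicting S_r(n) < S_r(n⁺).
module Submission where

open import Data.Bool using (true; false)
open import Data.List using (List; []; _∷_; map; filter; length; upTo; _++_; applyDownFrom; cartesianProductWith)
open import Data.List.Membership.Propositional using (_∈_)
open import Data.List.Membership.Propositional.Properties
  using (∈-filter⁺; ∈-filter⁻; ∈-upTo⁺; ∈-upTo⁻; ∈-map⁺; ∈-∃++; ∈-++⁻; ∈-++⁺ˡ; ∈-++⁺ʳ;
         ∈-cartesianProductWith⁺; ∈-applyDownFrom⁺; ∈-applyDownFrom⁻)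
open import Data.List.Properties using (map-id; map-cong-local; map-++)
open import Data.List.Relation.Binary.Permutation.Propositional using (_↭_; prep; ↭-refl; ↭-trans)
open import Data.List.Relation.Binary.Permutation.Propositional.Properties using (shift; map⁺)
open import Data.List.Relation.Binary.Subset.Propositional using (_⊆_)
open import Data.List.Relation.Unary.All as All using (All; []; _∷_)
open import Data.List.Relation.Unary.All.Properties using () renaming (map⁺ to All-map⁺; ++⁺ to All-++⁺)
open import Data.List.Relation.Unary.Any using (here; there)
open import Data.List.Relation.Unary.Unique.Propositional using (Unique; []; _∷_)
open import Data.List.Relation.Unary.Unique.Propositional.Properties
  using (filter⁺; upTo⁺; applyDownFrom⁺₁) renaming (++⁺ to Unique-++⁺)
open import Data.Nat
open import Data.Nat.Divisibility
open import Data.Nat.ListAction using (product; sum)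
open import Data.Nat.ListAction.Properties using (product-++; product-↭; sum-++; sum-↭; product≢0; ∈⇒∣product)
open import Data.Nat.Primality
open import Data.Nat.Primality.Factorisation using (factorise; factorisationHasAllPrimeFactors)
open import Data.Nat.Properties
open import Algebra.Properties.CommutativeSemigroup *-commutativeSemigroup
  using (interchange; x∙yz≈xy∙z; x∙yz≈y∙xz; x∙yz≈yx∙z; xy∙z≈y∙xz; xy∙z≈zy∙x)
open import Data.Product using (∃; _×_; _,_; proj₁; proj₂)
open import Data.Sum using (inj₁; inj₂)
open import Function using (id; _∘_)
open import Relation.Binary using (tri<; tri≈; tri>)
open import Relation.Binary.PropositionalEquality hiding (J)
open import Relation.Nullary using (¬_; yes; no; contradiction)
open import Relation.Nullary.Decidable using (_×-dec_)
open import Relation.Nullary.Reflects using (ofʸ; ofⁿ)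

open import Defs

private
  variable
    A : Set
    a b c e i k m n p q r : ℕ
    xs ys : List A
    ps : List ℕ
    f g : A → ℕ

product-map-* : ∀ (f g : A → ℕ) xs →
  product (map (λ x → f x * g x) xs) ≡ product (map f xs) * product (map g xs)
product-map-* f g []       = refl
product-map-* f g (x ∷ xs) = trans (cong (f x * g x *_) (product-map-* f g xs))
  (interchange (f x) (g x) (product (map f xs)) (product (map g xs)))

product-map-++ : ∀ (f : A → ℕ) xs ys →
  product (map f (xs ++ ys)) ≡ product (map f xs) * product (map f ys)
product-map-++ f xs ys = trans (cong product (map-++ f xs ys)) (product-++ (map f xs) (map f ys))

product-map-scale : ∀ c (g : A → ℕ) xs →
  product (map (λ x → c * g x) xs) ≡ c ^ length xs * product (map g xs)
product-map-scale c g []       = refl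
product-map-scale c g (x ∷ xs) = trans (cong (c * g x *_) (product-map-scale c g xs))
  (interchange c (g x) (c ^ length xs) (product (map g xs)))

product-map-mono : All (λ x → f x ≤ g x) xs → product (map f xs) ≤ product (map g xs)
product-map-mono []              = ≤-refl
product-map-mono (fx≤gx ∷ f≤g)   = *-mono-≤ fx≤gx (product-map-mono f≤g)

product-map-≤ : (∀ n → f n ≤ n) → ∀ ns → product (map f ns) ≤ product ns
product-map-≤ f≤id []       = ≤-refl
product-map-≤ f≤id (n ∷ ns) = *-mono-≤ (f≤id n) (product-map-≤ f≤id ns)

product-pos⁻ : ∀ {ns} → 0 < product ns → n ∈ ns → 0 < n
product-pos⁻ {ns = suc m ∷ _} _ (here refl) = z<s
product-pos⁻ {ns = m ∷ ns} 0<m*ns (there n∈ns) = product-pos⁻ (n≢0⇒n>0 ns≢0) n∈ns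
  where
  ns≢0 : product ns ≢ 0
  ns≢0 ns≡0 = n>0⇒n≢0 0<m*ns (trans (cong (m *_) ns≡0) (*-zeroʳ m))

sum-map-*ˡ : ∀ c ns → sum (map (c *_) ns) ≡ c * sum ns
sum-map-*ˡ c []       = sym (*-zeroʳ c)
sum-map-*ˡ c (n ∷ ns) = trans (cong (c * n +_) (sum-map-*ˡ c ns)) (sym (*-distribˡ-+ c n (sum ns)))

sum-cartesianProductWith-* : ∀ ms ns → sum (cartesianProductWith _*_ ms ns) ≡ sum ms * sum ns
sum-cartesianProductWith-* []       ns = refl
sum-cartesianProductWith-* (m ∷ ms) ns = begin
  sum (map (m *_) ns ++ cartesianProductWith _*_ ms ns)          ≡⟨ sum-++ (map (m *_) ns) _ ⟩
  sum (map (m *_) ns) + sum (cartesianProductWith _*_ ms ns)     ≡⟨ cong₂ _+_ (sum-map-*ˡ m ns) (sum-cartesianProductWith-* ms ns) ⟩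
  m * sum ns + sum ms * sum ns                                   ≡⟨ *-distribʳ-+ (sum ns) m (sum ms) ⟨
  (m + sum ms) * sum ns                                          ∎
  where open ≡-Reasoning

sum-applyDownFrom-+ : ∀ (y : ℕ → ℕ) m n →
  sum (applyDownFrom y (m + n)) ≡ sum (applyDownFrom (y ∘ (_+ n)) m) + sum (applyDownFrom y n)
sum-applyDownFrom-+ y zero    n = refl
sum-applyDownFrom-+ y (suc m) n =
  trans (cong (y (m + n) +_) (sum-applyDownFrom-+ y m n)) (sym (+-assoc (y (m + n)) _ _))

*≤*sum-applyDownFrom : ∀ {Q} c (y : ℕ → ℕ) m → (∀ {i} → i < m → Q ≤ c * y i) →
  m * Q ≤ c * sum (applyDownFrom y m)
*≤*sum-applyDownFrom c y zero    _   = z≤n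
*≤*sum-applyDownFrom {Q} c y (suc m) Q≤ = begin
  Q + m * Q                                 ≤⟨ +-mono-≤ (Q≤ ≤-refl) (*≤*sum-applyDownFrom c y m (Q≤ ∘ m<n⇒m<1+n)) ⟩
  c * y m + c * sum (applyDownFrom y m)     ≡⟨ *-distribˡ-+ c (y m) _ ⟨
  c * sum (applyDownFrom y (suc m))         ∎
  where open ≤-Reasoning

∈-++-∷⁻ : ∀ {x y : A} xs {ys} → y ∈ xs ++ x ∷ ys → y ≢ x → y ∈ xs ++ ys
∈-++-∷⁻ xs y∈ y≢x with ∈-++⁻ xs y∈
... | inj₁ y∈xs         = ∈-++⁺ˡ y∈xs
... | inj₂ (here y≡x)   = contradiction y≡x y≢x
... | inj₂ (there y∈ys) = ∈-++⁺ʳ xs y∈ys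

⊆⇒↭++ : Unique xs → xs ⊆ ys → ∃ λ zs → ys ↭ xs ++ zs
⊆⇒↭++ {xs = []} {ys} _ _ = ys , ↭-refl
⊆⇒↭++ {xs = x ∷ xs} (x∉xs ∷ xs-unique) x∷xs⊆ys with ∈-∃++ (x∷xs⊆ys (here refl))
... | as , bs , refl
  with ⊆⇒↭++ xs-unique (λ y∈xs → ∈-++-∷⁻ as (x∷xs⊆ys (there y∈xs)) (≢-sym (All.lookup x∉xs y∈xs)))
... | zs , as++bs↭xs++zs = zs , ↭-trans (shift x as bs) (prep x as++bs↭xs++zs)

product-↭-++ : ∀ {ms} ns ks → ms ↭ ns ++ ks → product ms ≡ product ns * product ks
product-↭-++ ns ks ms↭ns++ks = trans (product-↭ ms↭ns++ks) (product-++ ns ks)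

sum-mono-⊆ : ∀ {ns ms} → Unique ns → ns ⊆ ms → sum ns ≤ sum ms
sum-mono-⊆ {ns} ns-unique ns⊆ms with ⊆⇒↭++ ns-unique ns⊆ms
... | ks , ms↭ns++ks = begin
  sum ns            ≤⟨ m≤m+n (sum ns) (sum ks) ⟩
  sum ns + sum ks   ≡⟨ sum-++ ns ks ⟨
  sum (ns ++ ks)    ≡⟨ sum-↭ ms↭ns++ks ⟨
  _                 ∎
  where open ≤-Reasoning

product-map-ratio-⊆ : ∀ {f : ℕ → ℕ} {ns ms} → (∀ n → f n ≤ n) → Unique ns → ns ⊆ ms →
  product (map f ms) * product ns ≤ product ms * product (map f ns)
product-map-ratio-⊆ {f} {ns} {ms} f≤id ns-unique ns⊆ms with ⊆⇒↭++ ns-unique ns⊆ms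
... | ks , ms↭ns++ks = begin
  product (map f ms) * product ns
    ≡⟨ cong (_* product ns) (product-↭-++ (map f ns) (map f ks) f[ms]↭) ⟩
  product (map f ns) * product (map f ks) * product ns
    ≤⟨ *-monoˡ-≤ (product ns) (*-monoʳ-≤ (product (map f ns)) (product-map-≤ f≤id ks)) ⟩
  product (map f ns) * product ks * product ns
    ≡⟨ xy∙z≈zy∙x (product (map f ns)) (product ks) (product ns) ⟩
  product ns * product ks * product (map f ns)
    ≡⟨ cong (_* product (map f ns)) (product-↭-++ ns ks ms↭ns++ks) ⟨
  product ms * product (map f ns)
    ∎
  where
  open ≤-Reasoning
  f[ms]↭ : map f ms ↭ map f ns ++ map f ks
  f[ms]↭ = subst (map f ms ↭_) (map-++ f ns ks) (map⁺ f ms↭ns++ks)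

prime⇒>1 : Prime p → 1 < p
prime⇒>1 {p} p-prime = nonTrivial⇒n>1 p {{prime⇒nonTrivial p-prime}}

∃prime∣ : 1 < n → ∃ λ p → Prime p × p ∣ n
∃prime∣ {n@(suc _)} 1<n with factorise n
... | record { factors = [] ; isFactorisation = n≡1 } = contradiction n≡1 (>⇒≢ 1<n)
... | record { factors = p ∷ ps ; isFactorisation = n≡p*ps ; factorsPrime = p-prime ∷ _ } =
  p , p-prime , subst (p ∣_) (sym n≡p*ps) (m∣m*n (product ps))

prime∣prime⇒≡ : Prime q → Prime p → q ∣ p → q ≡ p
prime∣prime⇒≡ q-prime p-prime q∣p with prime⇒irreducible p-prime q∣p
... | inj₁ refl = contradiction q-prime ¬prime[1]
... | inj₂ q≡p = q≡p

prime∣^⇒≡ : Prime q → Prime p → ∀ k → q ∣ p ^ k → q ≡ p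
prime∣^⇒≡ q-prime p-prime zero q∣1 = contradiction (subst Prime (∣1⇒≡1 q∣1) q-prime) ¬prime[1]
prime∣^⇒≡ {p = p} q-prime p-prime (suc k) q∣p^k+1 with euclidsLemma p (p ^ k) q-prime q∣p^k+1
... | inj₁ q∣p   = prime∣prime⇒≡ q-prime p-prime q∣p
... | inj₂ q∣p^k = prime∣^⇒≡ q-prime p-prime k q∣p^k

n<m^n : 1 < m → ∀ n → n < m ^ n
n<m^n 1<m zero    = s≤s z≤n
n<m^n {m} 1<m (suc n) = begin-strict
  suc n       ≤⟨ n<m^n 1<m n ⟩
  m ^ n       <⟨ m<m*n (m ^ n) m 1<m ⟩
  m ^ n * m   ≡⟨ *-comm (m ^ n) m ⟩
  m * m ^ n   ∎
  where
  open ≤-Reasoning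
  instance
    m^n-nonZero : NonZero (m ^ n)
    m^n-nonZero = m^n≢0 m n {{>-nonZero (<-trans z<s 1<m)}}

^-monoʳ-∣ : ∀ p → m ≤ n → p ^ m ∣ p ^ n
^-monoʳ-∣ {m} {n} p m≤n = divides (p ^ (n ∸ m)) (begin
  p ^ n               ≡⟨ cong (p ^_) (sym (m∸n+n≡m m≤n)) ⟩
  p ^ (n ∸ m + m)     ≡⟨ ^-distribˡ-+-* p (n ∸ m) m ⟩
  p ^ (n ∸ m) * p ^ m ∎)
  where open ≡-Reasoning

^∣*⇒^∣ : Prime p → ¬ p ∣ c → ∀ k → p ^ k ∣ c * m → p ^ k ∣ m
^∣*⇒^∣ p-prime p∤c zero _ = 1∣ _
^∣*⇒^∣ {p} {c} {m} p-prime p∤c (suc k) p^k+1∣cm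
  with euclidsLemma c m p-prime (∣-trans (m∣m*n (p ^ k)) p^k+1∣cm)
... | inj₁ p∣c = contradiction p∣c p∤c
... | inj₂ (divides m′ refl) = subst (p * p ^ k ∣_) (*-comm p m′)
  (*-monoʳ-∣ p (^∣*⇒^∣ p-prime p∤c k
    (*-cancelˡ-∣ p {{prime⇒nonZero p-prime}} (subst (p * p ^ k ∣_) (cm′p≡pcm′) p^k+1∣cm))))
  where
  cm′p≡pcm′ : c * (m′ * p) ≡ p * (c * m′)
  cm′p≡pcm′ = trans (sym (*-assoc c m′ p)) (*-comm (c * m′) p)

geometric-sum : ∀ p n → sum (applyDownFrom (suc p ^_) n) * p + 1 ≡ suc p ^ n
geometric-sum p zero    = refl
geometric-sum p (suc n) = begin
  (suc p ^ n + s) * p + 1       ≡⟨ cong (_+ 1) (*-distribʳ-+ p (suc p ^ n) s) ⟩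
  suc p ^ n * p + s * p + 1     ≡⟨ +-assoc (suc p ^ n * p) (s * p) 1 ⟩
  suc p ^ n * p + (s * p + 1)   ≡⟨ cong (suc p ^ n * p +_) (geometric-sum p n) ⟩
  suc p ^ n * p + suc p ^ n     ≡⟨ +-comm (suc p ^ n * p) (suc p ^ n) ⟩
  suc p ^ n + suc p ^ n * p     ≡⟨ cong (suc p ^ n +_) (*-comm (suc p ^ n) p) ⟩
  suc p * suc p ^ n             ∎
  where
  open ≡-Reasoning
  s = sum (applyDownFrom (suc p ^_) n)

geometric-sum-bound : ∀ p .{{_ : NonZero p}} n → sum (applyDownFrom (p ^_) n) * (p ∸ 1) ≤ p ^ n
geometric-sum-bound (suc p) n =
  subst (sum (applyDownFrom (suc p ^_) n) * p ≤_) (geometric-sum p n) (m≤m+n _ 1)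

-- `v p n` runs a where-bound loop of Defs that cannot be named here. The metavariable
-- `v-loop` is solved to that loop by the with-abstraction of `suc k` in `v-loop-solution`,
-- so the loop's properties can be proved by induction on its counter.
mutual
  private
    v-loop : ℕ → ℕ → ℕ → ℕ
    v-loop = _

    v-loop-solution : ∀ p k → v p (suc k) ≡ v p (suc k)
    v-loop-solution p k with p ^ suc k ∣? suc k
    ... | yes _ = refl
    ... | no _ with suc k
    ...   | N = refl {x = v-loop p N k}

private
  p^v-loop∣ : ∀ p n k → p ^ v-loop p n k ∣ n
  p^v-loop∣ p n zero = 1∣ n
  p^v-loop∣ p n (suc k) with p ^ suc k ∣? n
  ... | yes p^k+1∣n = p^k+1∣n
  ... | no _        = p^v-loop∣ p n k

  ≤v-loop : ∀ p n k → i ≤ k → p ^ i ∣ n → i ≤ v-loop p n k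
  ≤v-loop p n zero i≤0 _ = i≤0
  ≤v-loop {i} p n (suc k) i≤k+1 p^i∣n with p ^ suc k ∣? n
  ... | yes _ = i≤k+1
  ... | no p^k+1∤n with i ≟ suc k
  ...   | yes refl = contradiction p^i∣n p^k+1∤n
  ...   | no i≢k+1 = ≤v-loop p n k (≤-pred (≤∧≢⇒< i≤k+1 i≢k+1)) p^i∣n

  v-loop≤ : ∀ p n k → v-loop p n k ≤ k
  v-loop≤ p n zero = z≤n
  v-loop≤ p n (suc k) with p ^ suc k ∣? n
  ... | yes _ = ≤-refl
  ... | no _  = m≤n⇒m≤1+n (v-loop≤ p n k)

v≤n : ∀ p n → v p n ≤ n
v≤n p n = v-loop≤ p n n

p^v∣n : ∀ p n → p ^ v p n ∣ n
p^v∣n p n = p^v-loop∣ p n n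

p^i∣n⇒i≤v : 1 < p → .{{NonZero n}} → p ^ i ∣ n → i ≤ v p n
p^i∣n⇒i≤v {p} {n} {i} 1<p p^i∣n = ≤v-loop p n n (<⇒≤ (<-≤-trans (n<m^n 1<p i) (∣⇒≤ p^i∣n))) p^i∣n

p^[1+v]∤n : 1 < p → .{{NonZero n}} → ¬ p ^ suc (v p n) ∣ n
p^[1+v]∤n 1<p p^[1+v]∣n = <-irrefl refl (p^i∣n⇒i≤v 1<p p^[1+v]∣n)

v-unique : 1 < p → .{{NonZero n}} → p ^ a ∣ n → ¬ p ^ suc a ∣ n → v p n ≡ a
v-unique {p} {n} {a} 1<p p^a∣n p^[1+a]∤n with <-cmp (v p n) a
... | tri< v<a _ _ = contradiction (∣-trans (^-monoʳ-∣ p v<a) p^a∣n) (p^[1+v]∤n 1<p)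
... | tri≈ _ v≡a _ = v≡a
... | tri> _ _ a<v = contradiction (∣-trans (^-monoʳ-∣ p a<v) (p^v∣n p n)) p^[1+a]∤n

∣⇒1≤v : .{{NonZero n}} → p ∣ n → 1 ≤ v p n
∣⇒1≤v {n@(suc _)} {p} p∣n = ≤v-loop p n n (s≤s z≤n) (subst (_∣ n) (sym (*-identityʳ p)) p∣n)

v-*-indivisible : Prime p → ¬ p ∣ c → .{{NonZero m}} → v p (c * m) ≡ v p m
v-*-indivisible {p} {c} {m} p-prime p∤c = v-unique (prime⇒>1 p-prime) {{c*m≢0}}
  (∣n⇒∣m*n c (p^v∣n p m))
  (p^[1+v]∤n (prime⇒>1 p-prime) ∘ ^∣*⇒^∣ p-prime p∤c (suc (v p m)))
  where
  c*m≢0 : NonZero (c * m)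
  c*m≢0 = m*n≢0 c m {{≢-nonZero (λ { refl → p∤c (p ∣0) })}}

v-split : Prime p → .{{NonZero n}} → ∃ λ m → NonZero m × n ≡ p ^ v p n * m × ¬ p ∣ m
v-split {p} {n} p-prime =
  quotient p^v∣ , quotient≢0 p^v∣ , m∣n⇒n≡m*quotient p^v∣ , p∤quotient
  where
  p^v∣ = p^v∣n p n
  p∤quotient : ¬ p ∣ quotient p^v∣
  p∤quotient p∣m = p^[1+v]∤n (prime⇒>1 p-prime)
    (subst₂ _∣_ (*-comm (p ^ v p n) p) (sym (m∣n⇒n≡m*quotient p^v∣)) (*-monoʳ-∣ (p ^ v p n) p∣m))

primeDivisors-unique : ∀ n → Unique (primeDivisors n)
primeDivisors-unique n = filter⁺ (λ q → prime? q ×-dec q ∣? n) (upTo⁺ (suc n))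

∈primeDivisors⁻ : q ∈ primeDivisors n → Prime q × q ∣ n
∈primeDivisors⁻ {n = n} = proj₂ ∘ ∈-filter⁻ (λ q → prime? q ×-dec q ∣? n) {xs = upTo (suc n)}

∈primeDivisors⁺ : .{{NonZero n}} → Prime q → q ∣ n → q ∈ primeDivisors n
∈primeDivisors⁺ {n} q-prime q∣n =
  ∈-filter⁺ (λ q → prime? q ×-dec q ∣? n) (∈-upTo⁺ (s≤s (∣⇒≤ q∣n))) (q-prime , q∣n)

product-^v≡ : ∀ {ps} → Unique ps → All Prime ps → .{{NonZero n}} →
  (∀ {q} → Prime q → q ∣ n → q ∈ ps) → product (map (λ q → q ^ v q n) ps) ≡ n
product-^v≡ {suc zero} {[]} _ _ _ = refl
product-^v≡ {suc (suc _)} {[]} _ _ covers with ∃prime∣ (s≤s (s≤s z≤n))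
... | q , q-prime , q∣n with covers q-prime q∣n
... | ()
product-^v≡ {n} {q ∷ ps} (q∉ps ∷ ps-unique) (q-prime ∷ ps-prime) covers
  with v-split {q} {n} q-prime
... | m , m≢0 , n≡q^v*m , q∤m = begin
  q ^ v q n * product (map (λ p → p ^ v p n) ps)
    ≡⟨ cong (q ^ v q n *_) (cong product (map-cong-local v≡)) ⟩
  q ^ v q n * product (map (λ p → p ^ v p m) ps)
    ≡⟨ cong (q ^ v q n *_) (product-^v≡ ps-unique ps-prime covers-m) ⟩
  q ^ v q n * m
    ≡⟨ n≡q^v*m ⟨
  n ∎
  where
  open ≡-Reasoning
  instance
    m-nonZero : NonZero m
    m-nonZero = m≢0
  v≡ : All (λ p → p ^ v p n ≡ p ^ v p m) ps
  v≡ = All.tabulate λ {p} p∈ps →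
    let p-prime = All.lookup ps-prime p∈ps
        p∤q^v   = λ p∣q^v → All.lookup q∉ps p∈ps (sym (prime∣^⇒≡ p-prime q-prime (v q n) p∣q^v))
    in cong (p ^_) (begin
    v p n               ≡⟨ cong (v p) n≡q^v*m ⟩
    v p (q ^ v q n * m) ≡⟨ v-*-indivisible {c = q ^ v q n} {m = m} p-prime p∤q^v ⟩
    v p m               ∎)
  covers-m : ∀ {p} → Prime p → p ∣ m → p ∈ ps
  covers-m {p} p-prime p∣m with covers p-prime (subst (p ∣_) (sym n≡q^v*m) (∣n⇒∣m*n (q ^ v q n) p∣m))
  ... | here refl  = contradiction p∣m q∤m
  ... | there p∈ps = p∈ps

product-primeDivisors-^v≡ : .{{NonZero n}} → product (map (λ q → q ^ v q n) (primeDivisors n)) ≡ n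
product-primeDivisors-^v≡ {n} =
  product-^v≡ (primeDivisors-unique n) (All.tabulate (proj₁ ∘ ∈primeDivisors⁻ {n = n})) ∈primeDivisors⁺

cofactor : ℕ → List ℕ → ℕ → ℕ
cofactor e ps n = product (map (λ p → p ^ (e ∸ v p n)) ps)

*-cofactor : Unique ps → All Prime ps → .{{NonZero n}} → (∀ {q} → Prime q → q ∣ n → q ∈ ps) → n ≤ e →
  n * cofactor e ps n ≡ product (map (_^ e) ps)
*-cofactor {ps} {n} {e} ps-unique ps-prime covers n≤e = begin
  n * cofactor e ps n
    ≡⟨ cong (_* cofactor e ps n) (product-^v≡ ps-unique ps-prime covers) ⟨
  product (map (λ p → p ^ v p n) ps) * cofactor e ps n
    ≡⟨ product-map-* (λ p → p ^ v p n) (λ p → p ^ (e ∸ v p n)) ps ⟨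
  product (map (λ p → p ^ v p n * p ^ (e ∸ v p n)) ps)
    ≡⟨ cong product (map-cong-local {xs = ps} (All.tabulate λ {p} _ → ^v*^[e∸v]≡^e p)) ⟩
  product (map (_^ e) ps) ∎
  where
  open ≡-Reasoning
  ^v*^[e∸v]≡^e : ∀ p → p ^ v p n * p ^ (e ∸ v p n) ≡ p ^ e
  ^v*^[e∸v]≡^e p = trans (sym (^-distribˡ-+-* p (v p n) (e ∸ v p n)))
    (cong (p ^_) (m+[n∸m]≡n (≤-trans (v≤n p n) n≤e)))

Sprimepow-pos⇒> : ∀ r q a → 0 < Sprimepow r q a → r < q
Sprimepow-pos⇒> r q a 0<S with q ≤ᵇ r | ≤ᵇ-reflects-≤ q r
... | true  | ofʸ _   = contradiction 0<S (<-irrefl refl)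
... | false | ofⁿ q≰r = ≰⇒> q≰r

Sprimepow-> : ∀ a → r < q → Sprimepow r q a ≡ q ^ (a ∸ 1) * (q ∸ r)
Sprimepow-> {r} {q} a r<q with q ≤ᵇ r | ≤ᵇ-reflects-≤ q r
... | true  | ofʸ q≤r = contradiction q≤r (<⇒≱ r<q)
... | false | ofⁿ _   = refl

q≤[1+r]*[q∸r] : r < q → q ≤ suc r * (q ∸ r)
q≤[1+r]*[q∸r] {r} {q} r<q = begin
  q                   ≡⟨ m∸n+n≡m (<⇒≤ r<q) ⟨
  q ∸ r + r           ≤⟨ +-monoʳ-≤ (q ∸ r) (m≤m*n r (q ∸ r) {{>-nonZero (m<n⇒0<n∸m r<q)}}) ⟩
  q ∸ r + r * (q ∸ r) ∎
  where open ≤-Reasoning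

q^a≤[1+r]*Sprimepow : ∀ a → r < q → q ^ suc a ≤ suc r * Sprimepow r q (suc a)
q^a≤[1+r]*Sprimepow {r} {q} a r<q = begin
  q * q ^ a                   ≤⟨ *-monoˡ-≤ (q ^ a) (q≤[1+r]*[q∸r] r<q) ⟩
  suc r * (q ∸ r) * q ^ a     ≡⟨ *-assoc (suc r) (q ∸ r) (q ^ a) ⟩
  suc r * ((q ∸ r) * q ^ a)   ≡⟨ cong (suc r *_) (trans (*-comm (q ∸ r) (q ^ a)) (sym (Sprimepow-> (suc a) r<q))) ⟩
  suc r * Sprimepow r q (suc a) ∎
  where open ≤-Reasoning

Sprimepow*q≡ : ∀ a → r < q → Sprimepow r q (suc a) * q ≡ q ^ suc a * (q ∸ r)
Sprimepow*q≡ {r} {q} a r<q = begin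
  Sprimepow r q (suc a) * q ≡⟨ cong (_* q) (Sprimepow-> (suc a) r<q) ⟩
  q ^ a * (q ∸ r) * q       ≡⟨ xy∙z≈y∙xz (q ^ a) (q ∸ r) q ⟩
  (q ∸ r) * (q ^ a * q)     ≡⟨ *-comm (q ∸ r) (q ^ a * q) ⟩
  q ^ a * q * (q ∸ r)       ≡⟨ cong (_* (q ∸ r)) (*-comm (q ^ a) q) ⟩
  q ^ suc a * (q ∸ r)       ∎
  where open ≡-Reasoning

B⇒r<primeDivisor : B r n → q ∈ primeDivisors n → r < q
B⇒r<primeDivisor {r} {n} {q} (_ , 0<S) q∈ =
  Sprimepow-pos⇒> r q (v q n) (product-pos⁻ 0<S (∈-map⁺ (λ q → Sprimepow r q (v q n)) q∈))

B⁺ : .{{NonZero n}} → (∀ {q} → Prime q → q ∣ n → r < q) → B r n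
B⁺ {n} {r} r<primes = >-nonZero⁻¹ n , >-nonZero⁻¹ (S r n) {{product≢0 (All-map⁺ (All.tabulate Sprimepow≢0))}}
  where
  Sprimepow≢0 : q ∈ primeDivisors n → NonZero (Sprimepow r q (v q n))
  Sprimepow≢0 {q} q∈ with ∈primeDivisors⁻ {n = n} q∈
  ... | q-prime , q∣n rewrite Sprimepow-> (v q n) (r<primes q-prime q∣n) =
    m*n≢0 (q ^ (v q n ∸ 1)) (q ∸ r) {{m^n≢0 q (v q n ∸ 1) {{prime⇒nonZero q-prime}}}}
      {{>-nonZero (m<n⇒0<n∸m (r<primes q-prime q∣n))}}

n≤[1+r]^ω*S : B r n → n ≤ suc r ^ ω n * S r n
n≤[1+r]^ω*S {r} {n} b@(1≤n , _) = begin
  n                                                     ≡⟨ product-primeDivisors-^v≡ ⟨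
  product (map (λ q → q ^ v q n) L)                     ≤⟨ product-map-mono (All.tabulate q^v≤) ⟩
  product (map (λ q → suc r * Sprimepow r q (v q n)) L) ≡⟨ product-map-scale (suc r) _ L ⟩
  suc r ^ ω n * S r n                                   ∎
  where
  open ≤-Reasoning
  instance
    n-nonZero : NonZero n
    n-nonZero = >-nonZero 1≤n
  L = primeDivisors n
  q^v≤ : q ∈ L → q ^ v q n ≤ suc r * Sprimepow r q (v q n)
  q^v≤ {q} q∈ with v q n | ∣⇒1≤v {n} {q} (proj₂ (∈primeDivisors⁻ q∈))
  ... | suc a | _ = q^a≤[1+r]*Sprimepow a (B⇒r<primeDivisor b q∈)

S*product≡*product∸ : B r n → S r n * product (primeDivisors n) ≡ n * product (map (_∸ r) (primeDivisors n))
S*product≡*product∸ {r} {n} b@(1≤n , _) = begin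
  S r n * product L
    ≡⟨ cong (S r n *_) (cong product (map-id L)) ⟨
  S r n * product (map id L)
    ≡⟨ product-map-* _ id L ⟨
  product (map (λ q → Sprimepow r q (v q n) * q) L)
    ≡⟨ cong product (map-cong-local (All.tabulate Sprimepow[v]*q≡)) ⟩
  product (map (λ q → q ^ v q n * (q ∸ r)) L)
    ≡⟨ product-map-* _ (_∸ r) L ⟩
  product (map (λ q → q ^ v q n) L) * product (map (_∸ r) L)
    ≡⟨ cong (_* product (map (_∸ r) L)) product-primeDivisors-^v≡ ⟩
  n * product (map (_∸ r) L) ∎
  where
  open ≡-Reasoning
  instance
    n-nonZero : NonZero n
    n-nonZero = >-nonZero 1≤n
  L = primeDivisors n
  Sprimepow[v]*q≡ : q ∈ L → Sprimepow r q (v q n) * q ≡ q ^ v q n * (q ∸ r)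
  Sprimepow[v]*q≡ {q} q∈ with v q n | ∣⇒1≤v {n} {q} (proj₂ (∈primeDivisors⁻ q∈))
  ... | suc a | _ = Sprimepow*q≡ a (B⇒r<primeDivisor b q∈)

S*product≤*product∸ : ∀ {T} → B r m → Unique T → T ⊆ primeDivisors m →
  S r m * product T ≤ m * product (map (_∸ r) T)
S*product≤*product∸ {r} {m} {T} m∈B T-unique T⊆ = *-cancelˡ-≤ (product L) {{L≢0}} (begin
  product L * (S r m * product T)               ≡⟨ x∙yz≈yx∙z (product L) (S r m) (product T) ⟩
  S r m * product L * product T                 ≡⟨ cong (_* product T) (S*product≡*product∸ m∈B) ⟩
  m * product (map (_∸ r) L) * product T        ≡⟨ *-assoc m _ (product T) ⟩
  m * (product (map (_∸ r) L) * product T)      ≤⟨ *-monoʳ-≤ m (product-map-ratio-⊆ (λ n → m∸n≤m n r) T-unique T⊆) ⟩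
  m * (product L * product (map (_∸ r) T))      ≡⟨ x∙yz≈y∙xz m (product L) _ ⟩
  product L * (m * product (map (_∸ r) T))      ∎)
  where
  open ≤-Reasoning
  L = primeDivisors m
  L≢0 : NonZero (product L)
  L≢0 = productOfPrimes≢0 (All.tabulate (proj₁ ∘ ∈primeDivisors⁻ {n = m}))

C*S≤ : ∀ {m T} C → B r m → Unique T → All (λ q → Prime q × r < q) T → product T ∣ m →
  C * product (map (_∸ r) T) ≤ product T → C * S r m ≤ m
C*S≤ {r} {m} {T} C m∈B@(1≤m , _) T-unique T-large-primes T∣m C*T∸r≤T =
  *-cancelʳ-≤ (C * S r m) m (product (map (_∸ r) T)) {{T∸r≢0}} (begin
    C * S r m * product (map (_∸ r) T)   ≡⟨ xy∙z≈y∙xz C (S r m) _ ⟩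
    S r m * (C * product (map (_∸ r) T)) ≤⟨ *-monoʳ-≤ (S r m) C*T∸r≤T ⟩
    S r m * product T                    ≤⟨ S*product≤*product∸ m∈B T-unique T⊆ ⟩
    m * product (map (_∸ r) T)           ∎)
  where
  open ≤-Reasoning
  T∸r≢0 : NonZero (product (map (_∸ r) T))
  T∸r≢0 = product≢0 (All-map⁺ (All.map (λ (_ , r<q) → >-nonZero (m<n⇒0<n∸m r<q)) T-large-primes))
  T⊆ : ∀ {q} → q ∈ T → q ∈ primeDivisors m
  T⊆ q∈T = ∈primeDivisors⁺ {{>-nonZero 1≤m}} (proj₁ (All.lookup T-large-primes q∈T)) (∣-trans (∈⇒∣product q∈T) T∣m)

product*^∈B : ∀ {T p} k → All (λ q → Prime q × r < q) T → Prime p → r < p → B r (product T * p ^ k)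
product*^∈B {r} {T} {p} k T-large-primes p-prime r<p = B⁺ {{m≢0}} r<divisor
  where
  T-prime = All.map proj₁ T-large-primes
  m≢0 : NonZero (product T * p ^ k)
  m≢0 = m*n≢0 _ _ {{productOfPrimes≢0 T-prime}} {{m^n≢0 p k {{prime⇒nonZero p-prime}}}}
  r<divisor : ∀ {q} → Prime q → q ∣ product T * p ^ k → r < q
  r<divisor q-prime q∣m with euclidsLemma (product T) (p ^ k) q-prime q∣m
  ... | inj₁ q∣T   = proj₂ (All.lookup T-large-primes (factorisationHasAllPrimeFactors q-prime q∣T T-prime))
  ... | inj₂ q∣p^k = subst (r <_) (sym (prime∣^⇒≡ q-prime p-prime k q∣p^k)) r<p

-- The products ∏_{p ∈ ps} p ^ αₚ with all αₚ ≤ e; for distinct primes, the divisors of ∏ p ^ e.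
powerProducts : ℕ → List ℕ → List ℕ
powerProducts e []       = 1 ∷ []
powerProducts e (p ∷ ps) = cartesianProductWith _*_ (applyDownFrom (p ^_) (suc e)) (powerProducts e ps)

∈-powerProducts : ∀ {α : ℕ → ℕ} → All (λ p → α p ≤ e) ps →
  product (map (λ p → p ^ α p) ps) ∈ powerProducts e ps
∈-powerProducts []                   = here refl
∈-powerProducts {ps = p ∷ _} (αp≤e ∷ α≤e) =
  ∈-cartesianProductWith⁺ _*_ (∈-applyDownFrom⁺ (p ^_) (s≤s αp≤e)) (∈-powerProducts α≤e)

sum-powerProducts-bound : ∀ e ps → All NonZero ps →
  sum (powerProducts e ps) * product (map (_∸ 1) ps) ≤ product (map (_^ e) ps) * product ps
sum-powerProducts-bound e [] [] = ≤-refl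
sum-powerProducts-bound e (p ∷ ps) (p≢0 ∷ ps≢0) = begin
  sum (powerProducts e (p ∷ ps)) * ((p ∸ 1) * product (map (_∸ 1) ps))
    ≡⟨ cong (_* _) (sum-cartesianProductWith-* (applyDownFrom (p ^_) (suc e)) (powerProducts e ps)) ⟩
  sum (applyDownFrom (p ^_) (suc e)) * sum (powerProducts e ps) * ((p ∸ 1) * product (map (_∸ 1) ps))
    ≡⟨ interchange (sum (applyDownFrom (p ^_) (suc e))) _ (p ∸ 1) _ ⟩
  sum (applyDownFrom (p ^_) (suc e)) * (p ∸ 1) * (sum (powerProducts e ps) * product (map (_∸ 1) ps))
    ≤⟨ *-mono-≤ (geometric-sum-bound p {{p≢0}} (suc e)) (sum-powerProducts-bound e ps ps≢0) ⟩
  p * p ^ e * (product (map (_^ e) ps) * product ps)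
    ≡⟨ cong (_* (product (map (_^ e) ps) * product ps)) (*-comm p (p ^ e)) ⟩
  p ^ e * p * (product (map (_^ e) ps) * product ps)
    ≡⟨ interchange (p ^ e) p (product (map (_^ e) ps)) (product ps) ⟩
  p ^ e * product (map (_^ e) ps) * (p * product ps) ∎
  where open ≤-Reasoning

-- With y k ≥ Q/(k+1), each dyadic block [2ʲ, 2ʲ⁺¹) of the sum contributes at least Q/2.
harmonic-dyadic : ∀ {Q} (y : ℕ → ℕ) j → (∀ {k} → k < 2 ^ j → Q ≤ suc k * y k) →
  j * Q ≤ 2 * sum (applyDownFrom y (2 ^ j))
harmonic-dyadic y zero    _  = z≤n
harmonic-dyadic {Q} y (suc j) Q≤ = begin
  Q + j * Q                         ≤⟨ +-mono-≤ upper-half (harmonic-dyadic y j (Q≤ ∘ λ k<d → <-≤-trans k<d d≤2d)) ⟩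
  2 * upper + 2 * lower             ≡⟨ *-distribˡ-+ 2 upper lower ⟨
  2 * (upper + lower)               ≡⟨ cong (2 *_) (sum-applyDownFrom-+ y d d) ⟨
  2 * sum (applyDownFrom y (d + d)) ≡⟨ cong (λ n → 2 * sum (applyDownFrom y n)) 2d≡d+d ⟨
  2 * sum (applyDownFrom y (2 * d)) ∎
  where
  open ≤-Reasoning
  d = 2 ^ j
  upper = sum (applyDownFrom (y ∘ (_+ d)) d)
  lower = sum (applyDownFrom y d)
  2d≡d+d : 2 * d ≡ d + d
  2d≡d+d = cong (d +_) (+-identityʳ d)
  d≤2d : d ≤ 2 * d
  d≤2d = m≤n*m d 2
  i+d<2d : ∀ {i} → i < d → i + d < 2 * d
  i+d<2d {i} i<d = subst (i + d <_) (sym 2d≡d+d) (+-monoˡ-< d i<d)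
  upper-half : Q ≤ 2 * upper
  upper-half = *-cancelˡ-≤ d {{m^n≢0 2 j}} (begin
    d * Q           ≤⟨ *≤*sum-applyDownFrom (2 * d) (y ∘ (_+ d)) d (λ i<d →
                         ≤-trans (Q≤ (i+d<2d i<d)) (*-monoˡ-≤ _ (i+d<2d i<d))) ⟩
    2 * d * upper   ≡⟨ xy∙z≈y∙xz 2 d upper ⟩
    d * (2 * upper) ∎)

euler-product-bound : ∀ J → Unique ps → All Prime ps → (∀ {q} → Prime q → q ≤ 2 ^ J → q ∈ ps) →
  J * product (map (_∸ 1) ps) ≤ 2 * product ps
euler-product-bound {ps} J ps-unique ps-prime covers = *-cancelˡ-≤ Q {{Q≢0}} (begin
  Q * (J * D)                          ≡⟨ x∙yz≈yx∙z Q J D ⟩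
  J * Q * D                            ≤⟨ *-monoˡ-≤ D (harmonic-dyadic y J (≤-reflexive ∘ sym ∘ *-y≡Q)) ⟩
  2 * sum cofactors * D                ≤⟨ *-monoˡ-≤ D (*-monoʳ-≤ 2 (sum-mono-⊆ cofactors-unique cofactors⊆)) ⟩
  2 * sum (powerProducts X ps) * D     ≡⟨ *-assoc 2 (sum (powerProducts X ps)) D ⟩
  2 * (sum (powerProducts X ps) * D)   ≤⟨ *-monoʳ-≤ 2 (sum-powerProducts-bound X ps ps≢0) ⟩
  2 * (Q * product ps)                 ≡⟨ x∙yz≈y∙xz 2 Q (product ps) ⟩
  Q * (2 * product ps)                 ∎)
  where
  open ≤-Reasoning
  X = 2 ^ J
  Q = product (map (_^ X) ps)
  D = product (map (_∸ 1) ps)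
  ps≢0 = All.map prime⇒nonZero ps-prime
  Q≢0 : NonZero Q
  Q≢0 = product≢0 (All-map⁺ (All.map (λ {p} p-prime → m^n≢0 p X {{prime⇒nonZero p-prime}}) ps-prime))
  -- y k = Q / (k + 1), computed without division
  y : ℕ → ℕ
  y k = cofactor X ps (suc k)
  cofactors = applyDownFrom y X
  *-y≡Q : ∀ {k} → k < X → suc k * y k ≡ Q
  *-y≡Q k<X = *-cofactor ps-unique ps-prime (λ q-prime q∣ → covers q-prime (≤-trans (∣⇒≤ q∣) k<X)) k<X
  y-injective : ∀ {i j} → i < X → j < X → y i ≡ y j → i ≡ j
  y-injective {i} {j} i<X j<X yi≡yj = suc-injective (*-cancelʳ-≡ (suc i) (suc j) (y i) {{yi≢0}}
    (trans (*-y≡Q i<X) (trans (sym (*-y≡Q j<X)) (cong (suc j *_) (sym yi≡yj)))))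
    where
    yi≢0 : NonZero (y i)
    yi≢0 = ≢-nonZero λ yi≡0 → ≢-nonZero⁻¹ Q {{Q≢0}}
      (trans (sym (*-y≡Q i<X)) (trans (cong (suc i *_) yi≡0) (*-zeroʳ (suc i))))
  cofactors-unique : Unique cofactors
  cofactors-unique = applyDownFrom⁺₁ y X λ j<i i<X yi≡yj →
    <⇒≢ j<i (sym (y-injective i<X (<-trans j<i i<X) yi≡yj))
  cofactors⊆ : cofactors ⊆ powerProducts X ps
  cofactors⊆ z∈cofactors with ∈-applyDownFrom⁻ y z∈cofactors
  ... | i , _ , refl =
    ∈-powerProducts {ps = ps} {α = λ p → X ∸ v p (suc i)} (All.tabulate λ {p} _ → m∸n≤m X (v p (suc i)))

primesIn : ℕ → ℕ → List ℕ
primesIn a b = filter (λ q → prime? q ×-dec a ≤? q) (upTo b)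

primesIn-unique : ∀ a b → Unique (primesIn a b)
primesIn-unique a b = filter⁺ (λ q → prime? q ×-dec a ≤? q) (upTo⁺ b)

∈primesIn⁻ : ∀ a b → q ∈ primesIn a b → Prime q × a ≤ q × q < b
∈primesIn⁻ a b q∈ with ∈-filter⁻ (λ q → prime? q ×-dec a ≤? q) {xs = upTo b} q∈
... | q<b , q-prime , a≤q = q-prime , a≤q , ∈-upTo⁻ q<b

∈primesIn⁺ : Prime q → a ≤ q → q < b → q ∈ primesIn a b
∈primesIn⁺ {a = a} q-prime a≤q q<b =
  ∈-filter⁺ (λ q → prime? q ×-dec a ≤? q) (∈-upTo⁺ q<b) (q-prime , a≤q)

primesIn-prime : ∀ a b → All Prime (primesIn a b)
primesIn-prime a b = All.tabulate (proj₁ ∘ ∈primesIn⁻ a b)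

euler-product-bound-primesIn : ∀ a J →
  J * product (map (_∸ 1) (primesIn 0 a ++ primesIn a (suc (2 ^ J)))) ≤
  2 * product (primesIn 0 a ++ primesIn a (suc (2 ^ J)))
euler-product-bound-primesIn a J =
  euler-product-bound J unique (All-++⁺ (primesIn-prime 0 a) (primesIn-prime a (suc (2 ^ J)))) covers
  where
  unique : Unique (primesIn 0 a ++ primesIn a (suc (2 ^ J)))
  unique = Unique-++⁺ (primesIn-unique 0 a) (primesIn-unique a (suc (2 ^ J))) λ (q∈small , q∈large) →
    <⇒≱ (proj₂ (proj₂ (∈primesIn⁻ 0 a q∈small))) (proj₁ (proj₂ (∈primesIn⁻ a (suc (2 ^ J)) q∈large)))
  covers : Prime q → q ≤ 2 ^ J → q ∈ primesIn 0 a ++ primesIn a (suc (2 ^ J))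
  covers {q} q-prime q≤2^J with q <? a
  ... | yes q<a = ∈-++⁺ˡ (∈primesIn⁺ q-prime z≤n q<a)
  ... | no q≮a  = ∈-++⁺ʳ (primesIn 0 a) (∈primesIn⁺ q-prime (≮⇒≥ q≮a) (s≤s q≤2^J))

product-ratio-unbounded : 1 ≤ r → ∀ C →
  ∃ λ T → Unique T × All (λ q → Prime q × r < q) T × C * product (map (_∸ r) T) ≤ product T
product-ratio-unbounded {r} 1≤r C =
  T , primesIn-unique (suc r) (suc (2 ^ J)) , All.tabulate T-large-primes , C*T∸r≤T
  where
  small = primesIn 0 (suc r)
  R = product small
  J = 2 * R * C
  T = primesIn (suc r) (suc (2 ^ J))
  T-large-primes : q ∈ T → Prime q × r < q
  T-large-primes q∈T with ∈primesIn⁻ (suc r) (suc (2 ^ J)) q∈T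
  ... | q-prime , r<q , _ = q-prime , r<q
  Ds = product (map (_∸ 1) small)
  DT = product (map (_∸ 1) T)
  instance
    Ds≢0 : NonZero Ds
    Ds≢0 = product≢0 (All-map⁺ (All.map (λ q-prime → >-nonZero (m<n⇒0<n∸m (prime⇒>1 q-prime)))
                                          (primesIn-prime 0 (suc r))))
    2R≢0 : NonZero (2 * R)
    2R≢0 = m*n≢0 2 R {{_}} {{productOfPrimes≢0 (primesIn-prime 0 (suc r))}}
  C*DT≤T : C * DT ≤ product T
  C*DT≤T = *-cancelˡ-≤ (2 * R) (begin
    2 * R * (C * DT)                      ≡⟨ x∙yz≈xy∙z (2 * R) C DT ⟩
    J * DT                                ≤⟨ *-monoʳ-≤ J (m≤n*m DT Ds) ⟩
    J * (Ds * DT)                         ≡⟨ cong (J *_) (product-map-++ (_∸ 1) small T) ⟨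
    J * product (map (_∸ 1) (small ++ T)) ≤⟨ euler-product-bound-primesIn (suc r) J ⟩
    2 * product (small ++ T)              ≡⟨ cong (2 *_) (product-++ small T) ⟩
    2 * (R * product T)                   ≡⟨ x∙yz≈xy∙z 2 R (product T) ⟩
    2 * R * product T                     ∎)
    where open ≤-Reasoning
  C*T∸r≤T : C * product (map (_∸ r) T) ≤ product T
  C*T∸r≤T = ≤-trans (*-monoʳ-≤ C (product-map-mono {xs = T} (All.tabulate λ {q} _ → ∸-monoʳ-≤ q 1≤r)))
                    C*DT≤T

prime-above : 1 ≤ r → ∃ λ p → Prime p × r < p
prime-above 1≤r with product-ratio-unbounded 1≤r 2
... | []    , _ , _                      , s≤s ()
... | p ∷ _ , _ , (p-prime , r<p) ∷ _ , _ = p , p-prime , r<p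

power-multiple-between : ∀ {M p n} .{{_ : NonZero M}} → 1 < p → M ≤ n →
  ∃ λ k → n < M * p ^ k × M * p ^ k ≤ p * n
power-multiple-between {M} {p} {n} 1<p M≤n =
  descend n (<-≤-trans (n<m^n 1<p n) (m≤n*m (p ^ n) M))
  where
  descend : ∀ k → n < M * p ^ k → ∃ λ k → n < M * p ^ k × M * p ^ k ≤ p * n
  descend zero n<M = contradiction M≤n (<⇒≱ (subst (n <_) (*-identityʳ M) n<M))
  descend (suc k) n<M*p^[1+k] with n <? M * p ^ k
  ... | yes n<M*p^k = descend k n<M*p^k
  ... | no n≮M*p^k  = suc k , n<M*p^[1+k] ,
    ≤-trans (≤-reflexive (x∙yz≈y∙xz M p (p ^ k))) (*-monoʳ-≤ p (≮⇒≥ n≮M*p^k))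

corollary3p1 : (r : ℕ) → 1 ≤ r →
    (K : ℕ) → ∃ λ N → (n : ℕ) → F r n → N ≤ n → K ≤ ω n
corollary3p1 r 1≤r K with prime-above 1≤r
... | p , p-prime , r<p with product-ratio-unbounded 1≤r (p * suc r ^ K)
... | T , T-unique , T-large-primes , C*T∸r≤T = product T , ω-bound
  where
  C = p * suc r ^ K
  instance
    T≢0 : NonZero (product T)
    T≢0 = productOfPrimes≢0 (All.map proj₁ T-large-primes)
    C≢0 : NonZero C
    C≢0 = m*n≢0 p (suc r ^ K) {{prime⇒nonZero p-prime}} {{m^n≢0 (suc r) K}}
  ω-bound : (n : ℕ) → F r n → product T ≤ n → K ≤ ω n
  ω-bound n (n∈B , S-increases) T≤n with K ≤? ω n
  ... | yes K≤ω = K≤ω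
  ... | no K≰ω with power-multiple-between (prime⇒>1 p-prime) T≤n
  ...   | k , n<n⁺ , n⁺≤p*n = contradiction (S-increases n⁺ n⁺∈B n<n⁺) (≤⇒≯ (*-cancelˡ-≤ C (begin
    C * S r n⁺                ≤⟨ C*S≤ C n⁺∈B T-unique T-large-primes (m∣m*n (p ^ k)) C*T∸r≤T ⟩
    n⁺                        ≤⟨ n⁺≤p*n ⟩
    p * n                     ≤⟨ *-monoʳ-≤ p (n≤[1+r]^ω*S n∈B) ⟩
    p * (suc r ^ ω n * S r n) ≤⟨ *-monoʳ-≤ p (*-monoˡ-≤ (S r n) (^-monoʳ-≤ (suc r) (<⇒≤ (≰⇒> K≰ω)))) ⟩
    p * (suc r ^ K * S r n)   ≡⟨ *-assoc p (suc r ^ K) (S r n) ⟨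
    C * S r n                 ∎)))
    where
    open ≤-Reasoning
    n⁺ = product T * p ^ k
    n⁺∈B = product*^∈B k T-large-primes p-prime r<p
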